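{- Define the numbers $a^n_{sj}, b^n_{sj}$ (for $n\ge1$, $1\le j\le n$), $\theta^n$ and $\phi^n$ (for $n\ge 2$) recursively as follows. - Base case: $a^1_{s1}=b^1_{s1}=1$. - For $n\ge 2$: $\theta^n=3a^{n-1}_{s,n-1}$. - $\phi^2=4$, and for $n>2$, $\phi^n=4\sum_{j=1}^{n-1}\left(\theta^n b^{n-1}_{sj}-3a^{n-1}_{sj}\right)$. - For $n\ge2$ and $j<n$: $a^n_{sj}=4a^{n-1}_{sj}$ and $b^n_{sj}=(1+\theta^n)b^{n-1}_{sj}$. - For $n\ge 2$: $a^n_{sn}=\phi^n$ and $b^n_{sn}=1$. Then for every $n\ge 3$, $$\frac13\cdot 2^{(2^n)}\le \phi^n\le \frac1{17}\cdot 2^{(2^{n+0.5})}.$$ -}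

module Defs where

open import Data.Bool using (if_then_else_)
open import Data.Nat using (ℕ; zero; suc; _<ᵇ_; _≡ᵇ_)
open import Data.Integer using (ℤ; +_; _+_; _-_; _*_)

sumFrom1 : ℕ → (ℕ → ℤ) → ℤ
sumFrom1 zero    f = + 0
sumFrom1 (suc k) f = sumFrom1 k f + f (suc k)

-- a n j = a^n_{sj}, b n j = b^n_{sj} (meaningful for n ≥ 1, 1 ≤ j ≤ n;
-- junk value 0 elsewhere), theta n = θ^n and phi n = φ^n (meaningful for n ≥ 2).
mutual
  a : ℕ → ℕ → ℤ
  a zero j = + 0
  a (suc zero) j = if j ≡ᵇ 1 then + 1 else + 0
  a (suc (suc m)) j =
    if j <ᵇ suc (suc m) then + 4 * a (suc m) j
    else (if j ≡ᵇ suc (suc m) then phi (suc (suc m)) else + 0)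

  b : ℕ → ℕ → ℤ
  b zero j = + 0
  b (suc zero) j = if j ≡ᵇ 1 then + 1 else + 0
  b (suc (suc m)) j =
    if j <ᵇ suc (suc m) then (+ 1 + theta (suc (suc m))) * b (suc m) j
    else (if j ≡ᵇ suc (suc m) then + 1 else + 0)

  theta : ℕ → ℤ
  theta zero = + 0
  theta (suc zero) = + 0
  theta (suc (suc m)) = + 3 * a (suc m) (suc m)

  phi : ℕ → ℤ
  phi zero = + 0
  phi (suc zero) = + 0
  phi (suc (suc zero)) = + 4
  phi (suc (suc (suc k))) =
    + 4 * sumFrom1 (suc (suc k))
            (λ j → theta (suc (suc (suc k))) * b (suc (suc k)) j - + 3 * a (suc (suc k)) j)

{-# OPTIONS --safe #-}
module Submission where

-- Write p, A, B for φ^n, Σ_j a^n_{sj}, Σ_j b^n_{sj}. Summing the defining recurrences over j gives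
--   φ^{n+1} = 12 (p B − A),   A′ = 4 A + φ^{n+1},   B′ = (1 + 3 p) B + 1,
-- so all three stay natural numbers, and the linear constraints 4 ≤ p, A ≤ 2 p, p + 8 ≤ 4 B ≤ 5 p
-- (tight at n = 2) are preserved. Under them 3 p² ≤ φ^{n+1} ≤ 15 p², so 3 φ^n grows at least and
-- (17 φ^n)^17 at most by squaring. Starting from 3 φ^3 = 432 ≥ 2^8 and (17 φ^3)^17 ≤ 2^192 this
-- gives 2^(2^n) ≤ 3 φ^n and 17 φ^n ≤ 2^((24/17) 2^n), and 24/17 < √2.

open import Defs
open import Data.Product using (_×_; _,_; proj₁)
open import Relation.Binary.PropositionalEquality using (_≡_; refl; sym; trans; cong; cong₂; module ≡-Reasoning)

module Powers where
  open import Data.Nat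
  open import Data.Nat.Properties
  open import Data.Nat.Tactic.RingSolver using (solve)
  open import Data.List using ([]; _∷_)
  open ≤-Reasoning

  m^2≡m*m : ∀ m → m ^ 2 ≡ m * m
  m^2≡m*m m = cong (m *_) (*-identityʳ m)

  ^-^-comm : ∀ m n o → (m ^ n) ^ o ≡ (m ^ o) ^ n
  ^-^-comm m n o = begin-equality
    (m ^ n) ^ o  ≡⟨ ^-*-assoc m n o ⟩
    m ^ (n * o)  ≡⟨ cong (m ^_) (*-comm n o) ⟩
    m ^ (o * n)  ≡⟨ ^-*-assoc m o n ⟨
    (m ^ o) ^ n  ∎

  ^-cancelʳ-≤ : ∀ n .{{_ : NonZero n}} {m o} → m ^ n ≤ o ^ n → m ≤ o
  ^-cancelʳ-≤ n mⁿ≤oⁿ = ≮⇒≥ (λ o<m → <⇒≱ (^-monoˡ-< n o<m) mⁿ≤oⁿ)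

  m^2^[1+n]≡[m^2^n]^2 : ∀ m n → m ^ (2 ^ suc n) ≡ (m ^ (2 ^ n)) ^ 2
  m^2^[1+n]≡[m^2^n]^2 m n = begin-equality
    m ^ (2 * 2 ^ n)  ≡⟨ cong (m ^_) (*-comm 2 (2 ^ n)) ⟩
    m ^ (2 ^ n * 2)  ≡⟨ ^-*-assoc m (2 ^ n) 2 ⟨
    (m ^ (2 ^ n)) ^ 2  ∎

  c*[k*k]≤k′⇒[c*k]^2≤c*k′ : ∀ c k {k′} → c * (k * k) ≤ k′ → (c * k) ^ 2 ≤ c * k′
  c*[k*k]≤k′⇒[c*k]^2≤c*k′ c k {k′} ck²≤k′ = begin
    (c * k) ^ 2        ≡⟨ m^2≡m*m (c * k) ⟩
    (c * k) * (c * k)  ≡⟨ solve (c ∷ k ∷ []) ⟩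
    c * (c * (k * k))  ≤⟨ *-monoʳ-≤ c ck²≤k′ ⟩
    c * k′             ∎

  k′≤c*[k*k]⇒c*k′≤[c*k]^2 : ∀ c k {k′} → k′ ≤ c * (k * k) → c * k′ ≤ (c * k) ^ 2
  k′≤c*[k*k]⇒c*k′≤[c*k]^2 c k {k′} k′≤ck² = begin
    c * k′             ≤⟨ *-monoʳ-≤ c k′≤ck² ⟩
    c * (c * (k * k))  ≡⟨ solve (c ∷ k ∷ []) ⟩
    (c * k) * (c * k)  ≡⟨ m^2≡m*m (c * k) ⟨
    (c * k) ^ 2        ∎

  iterated-squaring-lower : (f : ℕ → ℕ) {u : ℕ} → u ≤ f 0 → (∀ n → f n ^ 2 ≤ f (suc n)) →
                            ∀ n → u ^ (2 ^ n) ≤ f n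
  iterated-squaring-lower f {u} u≤f₀ sq≤ zero = begin
    u ^ 1  ≡⟨ ^-identityʳ u ⟩
    u      ≤⟨ u≤f₀ ⟩
    f 0    ∎
  iterated-squaring-lower f {u} u≤f₀ sq≤ (suc n) = begin
    u ^ (2 ^ suc n)    ≡⟨ m^2^[1+n]≡[m^2^n]^2 u n ⟩
    (u ^ (2 ^ n)) ^ 2  ≤⟨ ^-monoˡ-≤ 2 (iterated-squaring-lower f u≤f₀ sq≤ n) ⟩
    f n ^ 2            ≤⟨ sq≤ n ⟩
    f (suc n)          ∎

  iterated-squaring-upper : (f : ℕ → ℕ) {v : ℕ} → f 0 ≤ v → (∀ n → f (suc n) ≤ f n ^ 2) →
                            ∀ n → f n ≤ v ^ (2 ^ n)
  iterated-squaring-upper f {v} f₀≤v ≤sq zero = begin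
    f 0    ≤⟨ f₀≤v ⟩
    v      ≡⟨ ^-identityʳ v ⟨
    v ^ 1  ∎
  iterated-squaring-upper f {v} f₀≤v ≤sq (suc n) = begin
    f (suc n)          ≤⟨ ≤sq n ⟩
    f n ^ 2            ≤⟨ ^-monoˡ-≤ 2 (iterated-squaring-upper f f₀≤v ≤sq n) ⟩
    (v ^ (2 ^ n)) ^ 2  ≡⟨ m^2^[1+n]≡[m^2^n]^2 v n ⟨
    v ^ (2 ^ suc n)    ∎

  -- If a/b ≤ √2, then x ≤ 2^((a/b)N) and p/q ≥ √2 N give x ≤ 2^(p/q), i.e. x^q ≤ 2^p.
  x^q≤2^p : ∀ a b N x p q .{{_ : NonZero b}} → a * a ≤ 2 * (b * b) →
            x ^ b ≤ 2 ^ (a * N) → 2 * N ^ 2 * q ^ 2 ≤ p ^ 2 → x ^ q ≤ 2 ^ p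
  x^q≤2^p a b N x p q a²≤2b² xᵇ≤2^aN 2N²q²≤p² = ^-cancelʳ-≤ b (begin
    (x ^ q) ^ b        ≡⟨ ^-^-comm x q b ⟩
    (x ^ b) ^ q        ≤⟨ ^-monoˡ-≤ q xᵇ≤2^aN ⟩
    (2 ^ (a * N)) ^ q  ≡⟨ ^-*-assoc 2 (a * N) q ⟩
    2 ^ (a * N * q)    ≤⟨ ^-monoʳ-≤ 2 aNq≤bp ⟩
    2 ^ (b * p)        ≡⟨ cong (2 ^_) (*-comm b p) ⟩
    2 ^ (p * b)        ≡⟨ ^-*-assoc 2 p b ⟨
    (2 ^ p) ^ b        ∎)
    where
    aNq≤bp : a * N * q ≤ b * p
    aNq≤bp = ^-cancelʳ-≤ 2 (begin
      (a * N * q) ^ 2                    ≡⟨ m^2≡m*m (a * N * q) ⟩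
      (a * N * q) * (a * N * q)          ≡⟨ solve (a ∷ N ∷ q ∷ []) ⟩
      (a * a) * (N * N * (q * q))        ≤⟨ *-monoˡ-≤ (N * N * (q * q)) a²≤2b² ⟩
      2 * (b * b) * (N * N * (q * q))    ≡⟨ solve (b ∷ N ∷ q ∷ []) ⟩
      (b * b) * (2 * (N * N) * (q * q))  ≡⟨ cong₂ (λ u v → b * b * (2 * u * v)) (m^2≡m*m N) (m^2≡m*m q) ⟨
      (b * b) * (2 * N ^ 2 * q ^ 2)      ≤⟨ *-monoʳ-≤ (b * b) 2N²q²≤p² ⟩
      (b * b) * p ^ 2                    ≡⟨ cong (b * b *_) (m^2≡m*m p) ⟩
      (b * b) * (p * p)                  ≡⟨ solve (b ∷ p ∷ []) ⟩
      (b * p) * (b * p)                  ≡⟨ m^2≡m*m (b * p) ⟨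
      (b * p) ^ 2                        ∎)

module Recurrence where
  open import Data.Nat
  open import Data.Nat.Properties
  open import Data.Nat.Tactic.RingSolver using (solve)
  open import Data.List using ([]; _∷_)
  open import Data.Unit using (tt)
  open ≤-Reasoning
  open Powers

  -- (φ, α, β) stands for (φ^n, Σ_j a^n_{sj}, Σ_j b^n_{sj}); model m is the triple for n = m + 2.
  record State : Set where
    constructor ⟨_,_,_⟩
    field
      φ α β : ℕ

  open State public

  -- The truncated subtraction is exact on states satisfying Invariant (12α≤12pβ below).
  step : State → State
  step ⟨ p , α , β ⟩ = ⟨ p′ , 4 * α + p′ , (1 + 3 * p) * β + 1 ⟩
    where
    p′ = 12 * (p * β) ∸ 12 * α

  model : ℕ → State
  model zero    = ⟨ 4 , 8 , 5 ⟩
  model (suc m) = step (model m)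

  record Invariant (s : State) : Set where
    field
      4≤φ    : 4 ≤ φ s
      α≤2φ   : α s ≤ 2 * φ s
      φ+8≤4β : φ s + 8 ≤ 4 * β s
      4β≤5φ  : 4 * β s ≤ 5 * φ s

  module _ {p α β : ℕ} (inv : Invariant ⟨ p , α , β ⟩) where
    open Invariant inv

    private
      p′ : ℕ
      p′ = φ (step ⟨ p , α , β ⟩)

    3p²+12α≤12pβ : 3 * (p * p) + 12 * α ≤ 12 * (p * β)
    3p²+12α≤12pβ = begin
      3 * (p * p) + 12 * α        ≤⟨ +-monoʳ-≤ (3 * (p * p)) (*-monoʳ-≤ 12 α≤2φ) ⟩
      3 * (p * p) + 12 * (2 * p)  ≡⟨ solve (p ∷ []) ⟩
      3 * p * (p + 8)             ≤⟨ *-monoʳ-≤ (3 * p) φ+8≤4β ⟩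
      3 * p * (4 * β)             ≡⟨ solve (p ∷ β ∷ []) ⟩
      12 * (p * β)                ∎

    12α≤12pβ : 12 * α ≤ 12 * (p * β)
    12α≤12pβ = m+n≤o⇒n≤o (3 * (p * p)) 3p²+12α≤12pβ

    step-φ+12α≡12pβ : p′ + 12 * α ≡ 12 * (p * β)
    step-φ+12α≡12pβ = m∸n+n≡m 12α≤12pβ

    step-φ-lower : 3 * (p * p) ≤ p′
    step-φ-lower = +-cancelʳ-≤ (12 * α) (3 * (p * p)) p′ (begin
      3 * (p * p) + 12 * α  ≤⟨ 3p²+12α≤12pβ ⟩
      12 * (p * β)          ≡⟨ step-φ+12α≡12pβ ⟨
      p′ + 12 * α           ∎)

    step-φ-upper : p′ ≤ 15 * (p * p)
    step-φ-upper = begin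
      p′               ≤⟨ m≤m+n p′ (12 * α) ⟩
      p′ + 12 * α      ≡⟨ step-φ+12α≡12pβ ⟩
      12 * (p * β)     ≡⟨ solve (p ∷ β ∷ []) ⟩
      3 * p * (4 * β)  ≤⟨ *-monoʳ-≤ (3 * p) 4β≤5φ ⟩
      3 * p * (5 * p)  ≡⟨ solve (p ∷ []) ⟩
      15 * (p * p)     ∎

    step-invariant : Invariant (step ⟨ p , α , β ⟩)
    step-invariant = record
      { 4≤φ    = ≤-trans (m≤m+n 4 44) (≤-trans (*-monoʳ-≤ 3 (*-mono-≤ 4≤φ 4≤φ)) step-φ-lower)
      ; α≤2φ   = begin
          4 * α + p′  ≤⟨ +-monoˡ-≤ p′ 4α≤p′ ⟩
          p′ + p′     ≡⟨ cong (p′ +_) (+-identityʳ p′) ⟨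
          2 * p′      ∎
      ; φ+8≤4β = begin
          p′ + 8                           ≤⟨ +-mono-≤ (m≤m+n p′ (12 * α)) (+-monoˡ-≤ 4 4≤4β) ⟩
          (p′ + 12 * α) + (4 * β + 4)      ≡⟨ cong (_+ (4 * β + 4)) step-φ+12α≡12pβ ⟩
          12 * (p * β) + (4 * β + 4)       ≡⟨ solve (p ∷ β ∷ []) ⟩
          4 * ((1 + 3 * p) * β + 1)        ∎
      ; 4β≤5φ  = begin
          4 * ((1 + 3 * p) * β + 1)        ≡⟨ solve (p ∷ β ∷ []) ⟩
          12 * (p * β) + (4 * β + 4)       ≡⟨ cong (_+ (4 * β + 4)) step-φ+12α≡12pβ ⟨
          (p′ + 12 * α) + (4 * β + 4)      ≡⟨ +-assoc p′ (12 * α) (4 * β + 4) ⟩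
          p′ + (12 * α + (4 * β + 4))      ≤⟨ +-monoʳ-≤ p′ 12α+4β+4≤4p′ ⟩
          5 * p′                           ∎
      }
      where
      4≤4β : 4 ≤ 4 * β
      4≤4β = ≤-trans (≤-trans (m≤m+n 4 4) (m≤n+m 8 p)) φ+8≤4β

      12p≤p′ : 3 * (4 * p) ≤ p′
      12p≤p′ = ≤-trans (*-monoʳ-≤ 3 (*-monoˡ-≤ p 4≤φ)) step-φ-lower

      4α≤p′ : 4 * α ≤ p′
      4α≤p′ = begin
        4 * α        ≤⟨ *-monoʳ-≤ 4 α≤2φ ⟩
        4 * (2 * p)  ≡⟨ solve (p ∷ []) ⟩
        8 * p        ≤⟨ *-monoˡ-≤ p (m≤m+n 8 4) ⟩
        12 * p       ≡⟨ solve (p ∷ []) ⟩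
        3 * (4 * p)  ≤⟨ 12p≤p′ ⟩
        p′           ∎

      12α+4β+4≤4p′ : 12 * α + (4 * β + 4) ≤ 4 * p′
      12α+4β+4≤4p′ = begin
        12 * α + (4 * β + 4)        ≤⟨ +-mono-≤ (*-monoʳ-≤ 12 α≤2φ) (+-mono-≤ 4β≤5φ 4≤φ) ⟩
        12 * (2 * p) + (5 * p + p)  ≡⟨ solve (p ∷ []) ⟩
        30 * p                      ≤⟨ *-monoˡ-≤ p (m≤m+n 30 18) ⟩
        48 * p                      ≡⟨ solve (p ∷ []) ⟩
        4 * (3 * (4 * p))           ≤⟨ *-monoʳ-≤ 4 12p≤p′ ⟩
        4 * p′                      ∎

  model-invariant : ∀ m → Invariant (model m)
  model-invariant zero    = record
    { 4≤φ = ≤-refl ; α≤2φ = ≤-refl ; φ+8≤4β = m≤m+n 12 8 ; 4β≤5φ = ≤-refl }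
  model-invariant (suc m) = step-invariant (model-invariant m)

  lower-bound : ∀ m → 2 ^ (2 ^ (3 + m)) ≤ 3 * φ (model (suc m))
  lower-bound m = begin
    2 ^ (2 ^ (3 + m))      ≡⟨ cong (2 ^_) (^-distribˡ-+-* 2 3 m) ⟩
    2 ^ (8 * 2 ^ m)        ≡⟨ ^-*-assoc 2 8 (2 ^ m) ⟨
    (2 ^ 8) ^ (2 ^ m)      ≤⟨ iterated-squaring-lower 3φ (≤ᵇ⇒≤ _ _ tt) 3φ²≤3φ′ m ⟩
    3 * φ (model (suc m))  ∎
    where
    3φ : ℕ → ℕ
    3φ m = 3 * φ (model (suc m))
    3φ²≤3φ′ : ∀ m → 3φ m ^ 2 ≤ 3φ (suc m)
    3φ²≤3φ′ m = c*[k*k]≤k′⇒[c*k]^2≤c*k′ 3 (φ (model (suc m))) (step-φ-lower (model-invariant (suc m)))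

  upper-bound : ∀ m → (17 * φ (model (suc m))) ^ 17 ≤ 2 ^ (24 * 2 ^ (3 + m))
  upper-bound m = begin
    [17φ]¹⁷ m               ≤⟨ iterated-squaring-upper [17φ]¹⁷ (≤ᵇ⇒≤ _ _ tt) [17φ′]¹⁷≤[17φ]³⁴ m ⟩
    (2 ^ 192) ^ (2 ^ m)     ≡⟨ ^-*-assoc 2 192 (2 ^ m) ⟩
    2 ^ (192 * 2 ^ m)       ≡⟨ cong (2 ^_) (*-assoc 24 8 (2 ^ m)) ⟩
    2 ^ (24 * (8 * 2 ^ m))  ≡⟨ cong (λ e → 2 ^ (24 * e)) (^-distribˡ-+-* 2 3 m) ⟨
    2 ^ (24 * 2 ^ (3 + m))  ∎
    where
    [17φ]¹⁷ : ℕ → ℕ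
    [17φ]¹⁷ m = (17 * φ (model (suc m))) ^ 17
    φ′≤17φ² : ∀ m → φ (model (suc (suc m))) ≤ 17 * (φ (model (suc m)) * φ (model (suc m)))
    φ′≤17φ² m = let K = φ (model (suc m)) in
      ≤-trans (step-φ-upper (model-invariant (suc m))) (*-monoˡ-≤ (K * K) (m≤m+n 15 2))
    [17φ′]¹⁷≤[17φ]³⁴ : ∀ m → [17φ]¹⁷ (suc m) ≤ [17φ]¹⁷ m ^ 2
    [17φ′]¹⁷≤[17φ]³⁴ m = begin
      [17φ]¹⁷ (suc m)                      ≤⟨ ^-monoˡ-≤ 17 (k′≤c*[k*k]⇒c*k′≤[c*k]^2 17 (φ (model (suc m))) (φ′≤17φ² m)) ⟩
      ((17 * φ (model (suc m))) ^ 2) ^ 17  ≡⟨ ^-^-comm (17 * φ (model (suc m))) 2 17 ⟩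
      [17φ]¹⁷ m ^ 2                        ∎

open import Data.Nat using (ℕ; zero; suc; s≤s; _<ᵇ_)
  renaming (_≤_ to _≤ℕ_; _<_ to _<ℕ_; _+_ to _+ℕ_; _*_ to _*ℕ_; _^_ to _^ℕ_; _∸_ to _∸ℕ_)
open import Data.Nat.Properties using (≤-refl; m≤n⇒m≤1+n; <⇒<ᵇ; ≡⇒≡ᵇ; <⇒≤; ≤ᵇ⇒≤)
open import Data.Integer using (ℤ; +_; _+_; _-_; _*_; _^_; _≤_; +≤+)
open import Data.Integer.Properties using (pos-+; pos-*; ⊖-≥; m-n≡m⊖n; *-zeroʳ; *-distribˡ-+; module ≤-Reasoning)
open import Data.Integer.Tactic.RingSolver using (solve; solve-∀)
open import Data.Bool using (false)
open import Data.Bool.Properties using (T-≡)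
open import Data.List using ([]; _∷_)
open import Data.Unit using (tt)
open import Function.Bundles using (Equivalence)
open Recurrence using (State; ⟨_,_,_⟩; φ; α; β; step; model; Invariant; 12α≤12pβ; model-invariant;
                       lower-bound; upper-bound)
open Powers using (x^q≤2^p)

n<ᵇn≡false : ∀ n → (n <ᵇ n) ≡ false
n<ᵇn≡false zero    = refl
n<ᵇn≡false (suc n) = n<ᵇn≡false n

a-diag : ∀ m → a (suc (suc m)) (suc (suc m)) ≡ phi (suc (suc m))
a-diag m rewrite n<ᵇn≡false m | Equivalence.to T-≡ (≡⇒≡ᵇ m m refl) = refl

b-diag : ∀ m → b (suc (suc m)) (suc (suc m)) ≡ + 1
b-diag m rewrite n<ᵇn≡false m | Equivalence.to T-≡ (≡⇒≡ᵇ m m refl) = refl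

a-below : ∀ m {j} → j ≤ℕ suc (suc m) → a (suc (suc (suc m))) j ≡ + 4 * a (suc (suc m)) j
a-below m j≤ rewrite Equivalence.to T-≡ (<⇒<ᵇ (s≤s j≤)) = refl

b-below : ∀ m {j} → j ≤ℕ suc (suc m) →
          b (suc (suc (suc m))) j ≡ (+ 1 + theta (suc (suc (suc m)))) * b (suc (suc m)) j
b-below m j≤ rewrite Equivalence.to T-≡ (<⇒<ᵇ (s≤s j≤)) = refl

sumFrom1-cong : ∀ k {f g : ℕ → ℤ} → (∀ {j} → j ≤ℕ k → f j ≡ g j) → sumFrom1 k f ≡ sumFrom1 k g
sumFrom1-cong zero    f≗g = refl
sumFrom1-cong (suc k) f≗g = cong₂ _+_ (sumFrom1-cong k (λ j≤k → f≗g (m≤n⇒m≤1+n j≤k))) (f≗g ≤-refl)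

sumFrom1-*ˡ : ∀ k c f → sumFrom1 k (λ j → c * f j) ≡ c * sumFrom1 k f
sumFrom1-*ˡ zero    c f = sym (*-zeroʳ c)
sumFrom1-*ˡ (suc k) c f = begin
  sumFrom1 k (λ j → c * f j) + c * f (suc k)  ≡⟨ cong (_+ c * f (suc k)) (sumFrom1-*ˡ k c f) ⟩
  c * sumFrom1 k f + c * f (suc k)            ≡⟨ *-distribˡ-+ c (sumFrom1 k f) (f (suc k)) ⟨
  c * sumFrom1 (suc k) f                      ∎
  where open ≡-Reasoning

sumFrom1-linear : ∀ k c d f g →
                  sumFrom1 k (λ j → c * f j - d * g j) ≡ c * sumFrom1 k f - d * sumFrom1 k g
sumFrom1-linear zero    c d f g = solve (c ∷ d ∷ [])
sumFrom1-linear (suc k) c d f g = begin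
  sumFrom1 k (λ j → c * f j - d * g j) + (c * f (suc k) - d * g (suc k))
    ≡⟨ cong (_+ (c * f (suc k) - d * g (suc k))) (sumFrom1-linear k c d f g) ⟩
  (c * sumFrom1 k f - d * sumFrom1 k g) + (c * f (suc k) - d * g (suc k))
    ≡⟨ regroup c d (sumFrom1 k f) (sumFrom1 k g) (f (suc k)) (g (suc k)) ⟩
  c * sumFrom1 (suc k) f - d * sumFrom1 (suc k) g
    ∎
  where
  open ≡-Reasoning
  regroup : ∀ c d x y u v → (c * x - d * y) + (c * u - d * v) ≡ c * (x + u) - d * (y + v)
  regroup = solve-∀

Σa Σb : ℕ → ℤ
Σa n = sumFrom1 n (a n)
Σb n = sumFrom1 n (b n)

phi-suc : ∀ m → phi (suc (suc (suc m)))
              ≡ + 4 * (+ 3 * phi (suc (suc m)) * Σb (suc (suc m)) - + 3 * Σa (suc (suc m)))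
phi-suc m = begin
  phi (suc (suc (suc m)))
    ≡⟨ cong (+ 4 *_) (sumFrom1-linear (suc (suc m)) (theta (suc (suc (suc m)))) (+ 3) (b (suc (suc m))) (a (suc (suc m)))) ⟩
  + 4 * (+ 3 * a (suc (suc m)) (suc (suc m)) * Σb (suc (suc m)) - + 3 * Σa (suc (suc m)))
    ≡⟨ cong (λ t → + 4 * (+ 3 * t * Σb (suc (suc m)) - + 3 * Σa (suc (suc m)))) (a-diag m) ⟩
  + 4 * (+ 3 * phi (suc (suc m)) * Σb (suc (suc m)) - + 3 * Σa (suc (suc m)))
    ∎
  where open ≡-Reasoning

Σa-suc : ∀ m → Σa (suc (suc (suc m))) ≡ + 4 * Σa (suc (suc m)) + phi (suc (suc (suc m)))
Σa-suc m = cong₂ _+_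
  (trans (sumFrom1-cong (suc (suc m)) (a-below m)) (sumFrom1-*ˡ (suc (suc m)) (+ 4) (a (suc (suc m)))))
  (a-diag (suc m))

Σb-suc : ∀ m → Σb (suc (suc (suc m))) ≡ (+ 1 + + 3 * phi (suc (suc m))) * Σb (suc (suc m)) + + 1
Σb-suc m = cong₂ _+_
  (begin
    sumFrom1 (suc (suc m)) (b (suc (suc (suc m))))
      ≡⟨ sumFrom1-cong (suc (suc m)) (b-below m) ⟩
    sumFrom1 (suc (suc m)) (λ j → (+ 1 + theta (suc (suc (suc m)))) * b (suc (suc m)) j)
      ≡⟨ sumFrom1-*ˡ (suc (suc m)) (+ 1 + theta (suc (suc (suc m)))) (b (suc (suc m))) ⟩
    (+ 1 + + 3 * a (suc (suc m)) (suc (suc m))) * Σb (suc (suc m))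
      ≡⟨ cong (λ t → (+ 1 + + 3 * t) * Σb (suc (suc m))) (a-diag m) ⟩
    (+ 1 + + 3 * phi (suc (suc m))) * Σb (suc (suc m))
      ∎)
  (b-diag (suc m))
  where open ≡-Reasoning

Represents : ℕ → State → Set
Represents n s = phi n ≡ + φ s × Σa n ≡ + α s × Σb n ≡ + β s

pos-∸ : ∀ {m n} → n ≤ℕ m → + (m ∸ℕ n) ≡ + m - + n
pos-∸ {m} {n} n≤m = trans (sym (⊖-≥ n≤m)) (sym (m-n≡m⊖n m n))

pos-^ : ∀ m n → + (m ^ℕ n) ≡ (+ m) ^ n
pos-^ m zero    = refl
pos-^ m (suc n) = trans (pos-* m (m ^ℕ n)) (cong (+ m *_) (pos-^ m n))

represents-step : ∀ m {p α β} → Invariant ⟨ p , α , β ⟩ →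
                  Represents (suc (suc m)) ⟨ p , α , β ⟩ →
                  Represents (suc (suc (suc m))) (step ⟨ p , α , β ⟩)
represents-step m {p} {α} {β} inv (φ≡ , α≡ , β≡) = φ′≡ , α′≡ , β′≡
  where
  open ≡-Reasoning

  p′ : ℕ
  p′ = φ (step ⟨ p , α , β ⟩)

  φ′≡ : phi (suc (suc (suc m))) ≡ + p′
  φ′≡ = begin
    phi (suc (suc (suc m)))
      ≡⟨ phi-suc m ⟩
    + 4 * (+ 3 * phi (suc (suc m)) * Σb (suc (suc m)) - + 3 * Σa (suc (suc m)))
      ≡⟨ cong₂ (λ x y → + 4 * (x - y)) (cong₂ (λ u v → + 3 * u * v) φ≡ β≡) (cong (+ 3 *_) α≡) ⟩
    + 4 * (+ 3 * + p * + β - + 3 * + α)  ≡⟨ distribute (+ p) (+ β) (+ α) ⟩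
    + 12 * (+ p * + β) - + 12 * + α      ≡⟨ cong₂ _-_ (trans (pos-* 12 (p *ℕ β)) (cong (+ 12 *_) (pos-* p β)))
                                                      (pos-* 12 α) ⟨
    + (12 *ℕ (p *ℕ β)) - + (12 *ℕ α)     ≡⟨ pos-∸ (12α≤12pβ inv) ⟨
    + p′                                 ∎
    where
    distribute : ∀ x y z → + 4 * (+ 3 * x * y - + 3 * z) ≡ + 12 * (x * y) - + 12 * z
    distribute = solve-∀

  α′≡ : Σa (suc (suc (suc m))) ≡ + (4 *ℕ α +ℕ p′)
  α′≡ = begin
    Σa (suc (suc (suc m)))                            ≡⟨ Σa-suc m ⟩
    + 4 * Σa (suc (suc m)) + phi (suc (suc (suc m)))  ≡⟨ cong₂ (λ x y → + 4 * x + y) α≡ φ′≡ ⟩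
    + 4 * + α + + p′                                  ≡⟨ cong (_+ + p′) (pos-* 4 α) ⟨
    + (4 *ℕ α) + + p′                                 ≡⟨ pos-+ (4 *ℕ α) p′ ⟨
    + (4 *ℕ α +ℕ p′)                                  ∎

  β′≡ : Σb (suc (suc (suc m))) ≡ + ((1 +ℕ 3 *ℕ p) *ℕ β +ℕ 1)
  β′≡ = begin
    Σb (suc (suc (suc m)))                              ≡⟨ Σb-suc m ⟩
    (+ 1 + + 3 * phi (suc (suc m))) * Σb (suc (suc m)) + + 1
                                                        ≡⟨ cong₂ (λ x y → (+ 1 + + 3 * x) * y + + 1) φ≡ β≡ ⟩
    (+ 1 + + 3 * + p) * + β + + 1                       ≡⟨ cong (λ t → (+ 1 + t) * + β + + 1) (pos-* 3 p) ⟨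
    (+ 1 + + (3 *ℕ p)) * + β + + 1                      ≡⟨ cong (λ t → t * + β + + 1) (pos-+ 1 (3 *ℕ p)) ⟨
    + (1 +ℕ 3 *ℕ p) * + β + + 1                         ≡⟨ cong (_+ + 1) (pos-* (1 +ℕ 3 *ℕ p) β) ⟨
    + ((1 +ℕ 3 *ℕ p) *ℕ β) + + 1                        ≡⟨ pos-+ ((1 +ℕ 3 *ℕ p) *ℕ β) 1 ⟨
    + ((1 +ℕ 3 *ℕ p) *ℕ β +ℕ 1)                         ∎

model-represents : ∀ m → Represents (suc (suc m)) (model m)
model-represents zero    = refl , refl , refl
model-represents (suc m) = represents-step m (model-invariant m) (model-represents m)

corollary1 : (n : ℕ) → 3 ≤ℕ n →
  (+ (2 ^ℕ (2 ^ℕ n)) ≤ + 3 * phi n)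
  × ((p q : ℕ) → 0 <ℕ q → 2 *ℕ ((2 ^ℕ n) ^ℕ 2) *ℕ (q ^ℕ 2) <ℕ p ^ℕ 2 →
       (+ 17 * phi n) ^ q ≤ + (2 ^ℕ p))
corollary1 (suc (suc zero)) (s≤s (s≤s ()))
corollary1 (suc (suc (suc m))) _ = lower , upper
  where
  open ≤-Reasoning

  K : ℕ
  K = φ (model (suc m))
  phi≡K : phi (suc (suc (suc m))) ≡ + K
  phi≡K = proj₁ (model-represents (suc m))

  lower : + (2 ^ℕ (2 ^ℕ (3 +ℕ m))) ≤ + 3 * phi (suc (suc (suc m)))
  lower = begin
    + (2 ^ℕ (2 ^ℕ (3 +ℕ m)))       ≤⟨ +≤+ (lower-bound m) ⟩
    + (3 *ℕ K)                     ≡⟨ pos-* 3 K ⟩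
    + 3 * + K                      ≡⟨ cong (+ 3 *_) phi≡K ⟨
    + 3 * phi (suc (suc (suc m)))  ∎

  upper : (p q : ℕ) → 0 <ℕ q → 2 *ℕ ((2 ^ℕ (3 +ℕ m)) ^ℕ 2) *ℕ (q ^ℕ 2) <ℕ p ^ℕ 2 →
          (+ 17 * phi (suc (suc (suc m)))) ^ q ≤ + (2 ^ℕ p)
  upper p q _ 2N²q²<p² = begin
    (+ 17 * phi (suc (suc (suc m)))) ^ q  ≡⟨ cong (λ x → (+ 17 * x) ^ q) phi≡K ⟩
    (+ 17 * + K) ^ q                      ≡⟨ cong (_^ q) (pos-* 17 K) ⟨
    (+ (17 *ℕ K)) ^ q                     ≡⟨ pos-^ (17 *ℕ K) q ⟨
    + ((17 *ℕ K) ^ℕ q)                    ≤⟨ +≤+ (x^q≤2^p 24 17 (2 ^ℕ (3 +ℕ m)) (17 *ℕ K) p q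
                                                      (≤ᵇ⇒≤ _ _ tt) (upper-bound m) (<⇒≤ 2N²q²<p²)) ⟩
    + (2 ^ℕ p)                            ∎
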